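{- Let $\lambda\in\mathbf{k}$. For every finite set $X$ and every $F\in\mathrm{ADF}[X]$, $(\mathrm{id}\otimes\epsilon_\emptyset)\circ\Delta_{X,\emptyset}(F)=(\epsilon_\emptyset\otimes\mathrm{id})\circ\Delta_{\emptyset,X}(F)=F$ (identifying $\mathrm{ADF}[X]\otimes\mathbf{k}$ and $\mathbf{k}\otimes\mathrm{ADF}[X]$ with $\mathrm{ADF}[X]$).
   Context: $\mathbf{k}$ is a field of characteristic zero. Species: functors from finite sets with bijections to $\mathbf{k}$-vector spaces; Cauchy product $(P\otimes Q)[X]=\bigoplus_{X_1\sqcup X_2=X}P[X_1]\otimes Q[X_2]$. A twisted algebra is a species with natural, associative, unital products $m_{X,Y}:P[X]\otimes P[Y]\to P[X\sqcup Y]$; a Rota–Baxter species of weight $\lambda$ is one with a morphism $R$ satisfying $m_{X,Y}(R_Xx\otimes R_Yy)=R_{X\sqcup Y}m_{X,Y}(R_Xx\otimes y+x\otimes R_Yy+\lambda x\otimes y)$; morphisms of Rota–Baxter species preserve product, unit and operator. For a finite set $X$, $\mathrm{ADF}[X]$ has basis the planar rooted forests with exactly $|X|$ angles (gaps between consecutive leaves, inside a tree or between adjacent trees) decorated bijectively by $X$, written $T_1x_1\cdots x_mT_{m+1}$; $\bullet$ is the one-vertex tree and $\bullet x\bullet$ is two one-vertex trees separated by an angle decorated $x$. $R_X=B^+$ adds a new root joined to all roots. The product $\diamond$ (weight $\lambda$) is defined bilinearly by induction on depth: for trees $\bullet\diamond T'=T'$, $T\diamond\bullet=T$, $B^+(A)\diamond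 B^+(A')=B^+(B^+(A)\diamond A')+B^+(A\diamond B^+(A'))+\lambda B^+(A\diamond A')$; for forests $F=T_1x_1\cdots x_mT_{m+1}$, $G=T'_1y_1\cdots y_nT'_{n+1}$, $F\diamond G=T_1x_1\cdots x_m(T_{m+1}\diamond T'_1)y_1\cdots y_nT'_{n+1}$. $(\mathrm{ADF},\diamond,\bullet,B^+)$ is the free Rota–Baxter species of weight $\lambda$ on the species $O$ with $O[\{x\}]=\mathbf{k}\bullet x\bullet$ and $O[X]=0$ for non-singletons. $\epsilon_X:\mathrm{ADF}[X]\to\mathbf{k}$: $\epsilon_\emptyset(\bullet)=1$, $\epsilon_X(F)=0$ for all other basis forests. $\mathrm{ADF}\otimes\mathrm{ADF}$ is the Rota–Baxter species with componentwise product $(F_1\otimes G_1)(F_2\otimes G_2)=(F_1\diamond F_2)\otimes(G_1\diamond G_2)$ and operator $R^{(2)}_X(F\otimes G)=B^+(F)\otimes G+\epsilon_{X_1}(F)\bullet\otimes B^+(G)$ for $F\in\mathrm{ADF}[X_1]$, $G\in\mathrm{ADF}[X\setminus X_1]$. $\Delta:\mathrm{ADF}\to\mathrm{ADF}\otimes\mathrm{ADF}$ is the unique morphism of Rota–Baxter species with $\Delta_{\{x\}}(\bullet x\bullet)=\bullet x\bullet\otimes\bullet+\bullet\otimes\bullet x\bullet$ for every singleton $\{x\}$; its component $\Delta_{X_1,X_2}:\mathrm{ADF}[X_1\sqcup X_2]\to\mathrm{ADF}[X_1]\otimes\mathrm{ADF}[X_2]$ is the projection of $\Delta_{X_1\sqcup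 X_2}$ onto that summand. -}

module Defs where

open import Level using (Level; _⊔_) renaming (suc to lsuc)
open import Algebra.Bundles using (CommutativeRing)
open import Data.Nat using (ℕ; zero; suc)
open import Data.Nat.Properties using () renaming (_≟_ to _≟ℕ_)
open import Data.List using (List; []; _∷_; _++_; map; concatMap; filter; null)
open import Data.List.Relation.Unary.Unique.Propositional using (Unique)
open import Data.List.Relation.Binary.Permutation.Propositional using (_↭_)
open import Data.List.Relation.Binary.Disjoint.Propositional using (Disjoint)
open import Data.Product using (_×_; _,_; proj₁; proj₂; Σ)
open import Data.Product.Properties using (≡-dec)
open import Data.Bool using (Bool; true; false; if_then_else_; _∧_)
open import Data.Maybe using (Maybe; just; nothing)
import Data.Maybe as Maybe
open import Relation.Nullary using (¬_; Dec; yes; no; does)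
open import Relation.Binary.Definitions using (DecidableEquality)
open import Relation.Binary.PropositionalEquality using (_≡_; refl; cong; cong₂)
open import Function.Definitions using (Injective)

record Field (c ℓ : Level) : Set (lsuc (c ⊔ ℓ)) where
  field
    commutativeRing : CommutativeRing c ℓ
  open CommutativeRing commutativeRing
  field
    0≉1     : ¬ (0# ≈ 1#)
    inverse : ∀ x → ¬ (x ≈ 0#) → Σ Carrier (λ y → (x * y) ≈ 1#)
  open CommutativeRing commutativeRing public

module _ {c ℓ} (K : Field c ℓ) where
  open Field K
  fromℕ : ℕ → Carrier
  fromℕ zero    = 0#
  fromℕ (suc n) = 1# + fromℕ n

  CharZero : Set ℓ
  CharZero = ∀ n → ¬ (fromℕ (suc n) ≈ 0#)

-- Planar rooted forests with decorated angles.
-- A tree is either the one-vertex tree • or B⁺ F (a new root joined to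
-- all roots of the forest F).  A forest T₁ x₁ T₂ ... x_m T_{m+1} is
-- written  T₁ ∣ ((x₁ , T₂) ∷ ... ∷ (x_m , T_{m+1}) ∷ []).
-- Angle decorations are natural numbers; a finite set X of labels is a
-- duplicate-free list of naturals.

data Tree : Set
data Forest : Set

data Tree where
  •  : Tree
  B⁺ : Forest → Tree

data Forest where
  _∣_ : Tree → List (ℕ × Tree) → Forest

labelsT : Tree → List ℕ
labelsF : Forest → List ℕ
labelsL : List (ℕ × Tree) → List ℕ
labelsT •      = []
labelsT (B⁺ F) = labelsF F
labelsF (T ∣ l) = labelsT T ++ labelsL l
labelsL []            = []
labelsL ((x , T) ∷ l) = x ∷ (labelsT T ++ labelsL l)

relabelT : (ℕ → ℕ) → Tree → Tree
relabelF : (ℕ → ℕ) → Forest → Forest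
relabelL : (ℕ → ℕ) → List (ℕ × Tree) → List (ℕ × Tree)
relabelT σ •      = •
relabelT σ (B⁺ F) = B⁺ (relabelF σ F)
relabelF σ (T ∣ l) = relabelT σ T ∣ relabelL σ l
relabelL σ []            = []
relabelL σ ((x , T) ∷ l) = (σ x , relabelT σ T) ∷ relabelL σ l

private
  B⁺-inj : ∀ {F G : Forest} → B⁺ F ≡ B⁺ G → F ≡ G
  B⁺-inj refl = refl
  ∣-inj₁ : ∀ {T T' : Tree} {l l' : List (ℕ × Tree)} → (T ∣ l) ≡ (T' ∣ l') → T ≡ T'
  ∣-inj₁ refl = refl
  ∣-inj₂ : ∀ {T T' : Tree} {l l' : List (ℕ × Tree)} → (T ∣ l) ≡ (T' ∣ l') → l ≡ l'
  ∣-inj₂ refl = refl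
  ∷-inj : ∀ {x y : ℕ} {T T' : Tree} {l l' : List (ℕ × Tree)} → ((x , T) ∷ l) ≡ ((y , T') ∷ l') →
          (x ≡ y) × (T ≡ T') × (l ≡ l')
  ∷-inj refl = refl , refl , refl

_≟T_ : DecidableEquality Tree
_≟F_ : DecidableEquality Forest
_≟L_ : DecidableEquality (List (ℕ × Tree))
• ≟T • = yes refl
• ≟T B⁺ _ = no (λ ())
B⁺ _ ≟T • = no (λ ())
B⁺ F ≟T B⁺ G with F ≟F G
... | yes refl = yes refl
... | no ne = no (λ e → ne (B⁺-inj e))
(T ∣ l) ≟F (T' ∣ l') with T ≟T T' | l ≟L l'
... | yes refl | yes refl = yes refl
... | no ne | _ = no (λ e → ne (∣-inj₁ e))
... | yes _ | no ne = no (λ e → ne (∣-inj₂ e))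
[] ≟L [] = yes refl
[] ≟L (_ ∷ _) = no (λ ())
(_ ∷ _) ≟L [] = no (λ ())
((x , T) ∷ l) ≟L ((y , T') ∷ l') with x ≟ℕ y | T ≟T T' | l ≟L l'
... | yes refl | yes refl | yes refl = yes refl
... | no ne | _ | _ = no (λ e → ne (proj₁ (∷-inj e)))
... | yes _ | no ne | _ = no (λ e → ne (proj₁ (proj₂ (∷-inj e))))
... | yes _ | yes _ | no ne = no (λ e → ne (proj₂ (proj₂ (∷-inj e))))

_≟F2_ : DecidableEquality (Forest × Forest)
_≟F2_ = ≡-dec _≟F_ _≟F_

unitF : Forest
unitF = • ∣ []

dot : ℕ → Forest
dot x = • ∣ ((x , •) ∷ [])

rootF : Forest → Forest
rootF F = B⁺ F ∣ []

-- equality of finite label multisets (used to select a summand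
-- ADF[X₁] ⊗ ADF[X₂] of (ADF ⊗ ADF)[X₁ ⊔ X₂])
removeFirst : ℕ → List ℕ → Maybe (List ℕ)
removeFirst x [] = nothing
removeFirst x (y ∷ ys) =
  if does (x ≟ℕ y) then just ys else Maybe.map (y ∷_) (removeFirst x ys)

sameLabels : List ℕ → List ℕ → Bool
sameLabels [] ys = null ys
sameLabels (x ∷ xs) ys with removeFirst x ys
... | nothing  = false
... | just ys' = sameLabels xs ys'

module Lin {c ℓ} (K : Field c ℓ) where
  open Field K

  Lin : Set → Set c
  Lin A = List (Carrier × A)

  scale : ∀ {A} → Carrier → Lin A → Lin A
  scale a = map (λ p → (a * proj₁ p , proj₂ p))

  lmap : ∀ {A B} → (A → B) → Lin A → Lin B
  lmap f = map (λ p → (proj₁ p , f (proj₂ p)))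

  ext : ∀ {A B} → (A → Lin B) → Lin A → Lin B
  ext f = concatMap (λ p → scale (proj₁ p) (f (proj₂ p)))

  ext₂ : ∀ {A B C} → (A → B → Lin C) → Lin A → Lin B → Lin C
  ext₂ f v w = ext (λ a → ext (λ b → f a b) w) v

  coeff : ∀ {A} → DecidableEquality A → Lin A → A → Carrier
  coeff _≟_ [] a = 0#
  coeff _≟_ ((x , b) ∷ v) a = (if does (b ≟ a) then x else 0#) + coeff _≟_ v a

  EqV : ∀ {A} → DecidableEquality A → Lin A → Lin A → Set (ℓ)
  EqV _≟_ v w = ∀ a → coeff _≟_ v a ≈ coeff _≟_ w a

module ADF {c ℓ} (K : Field c ℓ) (w : Field.Carrier K) where
  open Field K
  open Lin K public

  _≈F_ : Lin Forest → Lin Forest → Set ℓ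
  _≈F_ = EqV _≟F_

  _≈₂_ : Lin (Forest × Forest) → Lin (Forest × Forest) → Set ℓ
  _≈₂_ = EqV _≟F2_

  -- product of trees, and of forests T₁x₁…T_{m+1} ⋄ T'₁y₁…T'_{n+1}
  -- = T₁x₁…x_m (T_{m+1} ⋄ T'₁) y₁…T'_{n+1}
  tp    : Tree → Tree → Lin Tree
  merge : Tree → List (ℕ × Tree) → Tree → List (ℕ × Tree) → Lin Forest
  tp • T' = (1# , T') ∷ []
  tp T • = (1# , T) ∷ []
  tp s@(B⁺ (T ∣ l)) s'@(B⁺ (T' ∣ l')) =
       lmap B⁺ (merge s [] T' l')
    ++ lmap B⁺ (merge T l s' [])
    ++ scale w (lmap B⁺ (merge T l T' l'))
  merge T [] T' l' = lmap (λ t → t ∣ l') (tp T T')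
  merge T ((x , T₂) ∷ l) T' l' =
    lmap (λ { (t ∣ r) → T ∣ ((x , t) ∷ r) }) (merge T₂ l T' l')

  _⋄_ : Forest → Forest → Lin Forest
  (T ∣ l) ⋄ (T' ∣ l') = merge T l T' l'

  ε : Forest → Carrier
  ε (• ∣ []) = 1#
  ε _        = 0#

  _⊗_ : Lin Forest → Lin Forest → Lin (Forest × Forest)
  _⊗_ = ext₂ (λ a b → (1# , (a , b)) ∷ [])

  _⋆_ : Lin (Forest × Forest) → Lin (Forest × Forest) → Lin (Forest × Forest)
  _⋆_ = ext₂ (λ p q → (proj₁ p ⋄ proj₁ q) ⊗ (proj₂ p ⋄ proj₂ q))

  R2 : Lin (Forest × Forest) → Lin (Forest × Forest)
  R2 = ext (λ p → (1# , (rootF (proj₁ p) , proj₂ p))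
                 ∷ (ε (proj₁ p) , (unitF , rootF (proj₂ p))) ∷ [])

  relabel₂ : (ℕ → ℕ) → Lin (Forest × Forest) → Lin (Forest × Forest)
  relabel₂ σ = lmap (λ p → (relabelF σ (proj₁ p) , relabelF σ (proj₂ p)))

  Δ̂ : (Forest → Lin (Forest × Forest)) → Lin Forest → Lin (Forest × Forest)
  Δ̂ δ = ext δ

  -- δ (extended linearly) is a morphism of Rota–Baxter species
  -- ADF → ADF ⊗ ADF sending • x • to • x • ⊗ • + • ⊗ • x •
  record IsΔ (δ : Forest → Lin (Forest × Forest)) : Set ℓ where
    field
      -- maps ADF[X] into (ADF ⊗ ADF)[X] = ⊕_{X₁⊔X₂=X} ADF[X₁] ⊗ ADF[X₂]
      graded  : ∀ F → Unique (labelsF F) → ∀ G H →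
                ¬ ((labelsF G ++ labelsF H) ↭ labelsF F) →
                coeff _≟F2_ (δ F) (G , H) ≈ 0#
      natural : ∀ (σ : ℕ → ℕ) → Injective _≡_ _≡_ σ →
                ∀ F → Unique (labelsF F) →
                δ (relabelF σ F) ≈₂ relabel₂ σ (δ F)
      unit    : δ unitF ≈₂ ((1# , (unitF , unitF)) ∷ [])
      mult    : ∀ F G → Unique (labelsF F) → Unique (labelsF G) →
                Disjoint (labelsF F) (labelsF G) →
                Δ̂ δ (F ⋄ G) ≈₂ (δ F ⋆ δ G)
      oper    : ∀ F → Unique (labelsF F) → δ (rootF F) ≈₂ R2 (δ F)
      gen     : ∀ x → δ (dot x) ≈₂ ((1# , (dot x , unitF)) ∷ (1# , (unitF , dot x)) ∷ [])

  proj : List ℕ → List ℕ → Lin (Forest × Forest) → Lin (Forest × Forest)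
  proj X₁ X₂ = filter (λ e → Data.Bool.T? (sameLabels (labelsF (proj₁ (proj₂ e))) X₁
                                     ∧ sameLabels (labelsF (proj₂ (proj₂ e))) X₂))

  id⊗ε : Lin (Forest × Forest) → Lin Forest
  id⊗ε = ext (λ p → (ε (proj₂ p) , proj₁ p) ∷ [])

  ε⊗id : Lin (Forest × Forest) → Lin Forest
  ε⊗id = ext (λ p → (ε (proj₁ p) , proj₂ p) ∷ [])

module Submission where

-- By linearity it suffices to treat a basis forest F with distinct labels.  The invariant is that
-- Δ F agrees with F ⊗ • on the pairs whose right factor is •, and with • ⊗ F on the pairs whose
-- left factor is •.  It holds for • and for the generators • x •, and it is preserved by B⁺ and by
-- every product A ⋄ B that is a single forest: a product P ⋄ Q contains the unit forest only when
-- P = Q = •, and R⁽²⁾ never sends a pair from outside a slice into it (for the slice • ⊗ ADF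
-- because ε(P) = 0 when P ≠ •).  Every forest is built from these pieces, and id ⊗ ε and ε ⊗ id
-- only read the respective slices.

open import Defs
open import Data.Nat using (ℕ)
open import Data.List using (List; [])
open import Data.List.Relation.Unary.All using (All)
open import Data.List.Relation.Unary.Unique.Propositional using (Unique)
open import Data.List.Relation.Binary.Permutation.Propositional using (_↭_)
open import Data.Product using (_×_; proj₂)

open import Data.Bool using (Bool; true; false; if_then_else_; _∧_; T?)
open import Data.Empty using (⊥-elim)
open import Data.List using (_∷_; _++_; map; filter; deduplicate)
open import Data.List.Properties using (++-assoc; ++-identityʳ)
open import Data.List.Membership.Propositional using (_∈_)
open import Data.List.Membership.Propositional.Properties using (∈-++⁺ˡ; ∈-++⁺ʳ; ∈-deduplicate⁺)
open import Data.List.Relation.Binary.Disjoint.Propositional using (Disjoint)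
open import Data.List.Relation.Binary.Permutation.Propositional
  using (↭-refl; ↭-trans; ↭-sym; prep; ↭-swap; ↭⇒↭ₛ)
open import Data.List.Relation.Binary.Permutation.Propositional.Properties
  using (↭-empty-inv; ∈-resp-↭; drop-∷)
import Data.List.Relation.Binary.Permutation.Setoid.Properties as PermutationSetoid
open import Data.List.Relation.Binary.Subset.Propositional using (_⊆_)
open import Data.List.Relation.Unary.All as All using ([]; _∷_)
import Data.List.Relation.Unary.All.Properties as AllP
open import Data.List.Relation.Unary.AllPairs using ([]; _∷_)
open import Data.List.Relation.Unary.Any using (here; there)
import Data.List.Relation.Unary.Unique.DecPropositional.Properties as UniqueDec
open import Data.Maybe using (just)
open import Data.Nat.Properties using () renaming (_≟_ to _≟ℕ_)
open import Data.Product using (_,_; proj₁; ∃-syntax)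
open import Data.Sum as Sum using (_⊎_; inj₁; inj₂)
open import Function using (_∘_)
open import Relation.Binary.Bundles using (Setoid)
open import Relation.Binary.Definitions using (DecidableEquality)
open import Relation.Binary.PropositionalEquality as ≡ using (_≡_; _≢_)
import Relation.Binary.Reasoning.Setoid as SetoidReasoning
open import Relation.Nullary using (¬_; yes; no; does)
open import Relation.Nullary.Decidable using (dec-true; dec-false)
open import Relation.Unary using (Decidable)

removeFirst-∈ : ∀ {x ys} → x ∈ ys → ∃[ zs ] removeFirst x ys ≡ just zs × ys ↭ x ∷ zs
removeFirst-∈ {x} {y ∷ ys} x∈y∷ys with x ≟ℕ y
... | yes ≡.refl rewrite dec-true (x ≟ℕ x) ≡.refl = ys , ≡.refl , ↭-refl
... | no x≢y rewrite dec-false (x ≟ℕ y) x≢y with x∈y∷ys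
...   | here x≡y = ⊥-elim (x≢y x≡y)
...   | there x∈ys with removeFirst-∈ x∈ys
...     | zs , eq , ys↭x∷zs rewrite eq =
  y ∷ zs , ≡.refl , ↭-trans (prep y ys↭x∷zs) (↭-swap y x ↭-refl)

sameLabels-↭ : ∀ {xs ys} → xs ↭ ys → sameLabels xs ys ≡ true
sameLabels-↭ {[]} []↭ys with ↭-empty-inv (↭-sym []↭ys)
... | ≡.refl = ≡.refl
sameLabels-↭ {x ∷ xs} x∷xs↭ys with removeFirst-∈ (∈-resp-↭ x∷xs↭ys (here ≡.refl))
... | zs , eq , ys↭x∷zs rewrite eq = sameLabels-↭ (drop-∷ (↭-trans x∷xs↭ys ys↭x∷zs))

selects : List ℕ → List ℕ → Forest × Forest → Bool
selects X₁ X₂ p = sameLabels (labelsF (proj₁ p)) X₁ ∧ sameLabels (labelsF (proj₂ p)) X₂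

Unique-resp-↭ : ∀ {A : Set} {xs ys : List A} → xs ↭ ys → Unique xs → Unique ys
Unique-resp-↭ {A} xs↭ys = PermutationSetoid.Unique-resp-↭ (≡.setoid A) (↭⇒↭ₛ xs↭ys)

Unique-++⁻ : ∀ {A : Set} (xs : List A) {ys} → Unique (xs ++ ys) →
             Unique xs × Unique ys × Disjoint xs ys
Unique-++⁻ []       Uys                  = [] , Uys , λ { (() , _) }
Unique-++⁻ (x ∷ xs) {ys} (x∉xs++ys ∷ Uxs++ys) with Unique-++⁻ xs Uxs++ys
... | Uxs , Uys , xs#ys = AllP.++⁻ˡ xs x∉xs++ys ∷ Uxs , Uys , x∷xs#ys
  where
    x∷xs#ys : Disjoint (x ∷ xs) ys
    x∷xs#ys (here ≡.refl , x∈ys) = All.lookup (AllP.++⁻ʳ xs x∉xs++ys) x∈ys ≡.refl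
    x∷xs#ys (there v∈xs  , v∈ys) = xs#ys (v∈xs , v∈ys)

Unique-split-at : ∀ {A : Set} (xs : List A) x ys → Unique (xs ++ x ∷ ys) →
                  Unique (xs ++ x ∷ []) × Unique ys × Disjoint (xs ++ x ∷ []) ys
Unique-split-at xs x ys = Unique-++⁻ (xs ++ x ∷ []) ∘ ≡.subst Unique (≡.sym (++-assoc xs (x ∷ []) ys))

Unique-split-last : ∀ {A : Set} (xs : List A) x → Unique (xs ++ x ∷ []) →
                    Unique (xs ++ []) × Unique (x ∷ []) × Disjoint (xs ++ []) (x ∷ [])
Unique-split-last xs x = Unique-++⁻ (xs ++ []) ∘ ≡.subst (λ zs → Unique (zs ++ x ∷ [])) (≡.sym (++-identityʳ xs))

module LinearCombinations {c ℓ} (K : Field c ℓ) where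
  open Field K
  open Lin K
  open SetoidReasoning setoid
  open import Algebra.Properties.CommutativeSemigroup +-commutativeSemigroup using (interchange)
  open import Algebra.Properties.CommutativeSemigroup *-commutativeSemigroup using (x∙yz≈y∙xz)

  eval : {A : Set} → (A → Carrier) → Lin A → Carrier
  eval g []            = 0#
  eval g ((a , p) ∷ V) = a * g p + eval g V

  module _ {A : Set} where

    eval-cong : ∀ {g h : A → Carrier} V → (∀ p → g p ≈ h p) → eval g V ≈ eval h V
    eval-cong []            g≈h = refl
    eval-cong ((a , p) ∷ V) g≈h = +-cong (*-cong refl (g≈h p)) (eval-cong V g≈h)

    eval-cong-All : ∀ {P : A → Set} {g h : A → Carrier} {V} → All (P ∘ proj₂) V →
                    (∀ p → P p → g p ≈ h p) → eval g V ≈ eval h V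
    eval-cong-All []        g≈h = refl
    eval-cong-All (Pp ∷ PV) g≈h = +-cong (*-cong refl (g≈h _ Pp)) (eval-cong-All PV g≈h)

    eval-zero : ∀ {g : A → Carrier} V → (∀ p → g p ≈ 0#) → eval g V ≈ 0#
    eval-zero []            g≈0 = refl
    eval-zero ((a , p) ∷ V) g≈0 =
      trans (+-cong (trans (*-cong refl (g≈0 p)) (zeroʳ a)) (eval-zero V g≈0)) (+-identityʳ 0#)

    eval-++ : ∀ {g : A → Carrier} V W → eval g (V ++ W) ≈ eval g V + eval g W
    eval-++ []            W = sym (+-identityˡ _)
    eval-++ ((a , p) ∷ V) W = trans (+-cong refl (eval-++ V W)) (sym (+-assoc _ _ _))

    eval-scale : ∀ {g : A → Carrier} a V → eval g (scale a V) ≈ a * eval g V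
    eval-scale a []            = sym (zeroʳ a)
    eval-scale a ((b , p) ∷ V) =
      trans (+-cong (*-assoc a b _) (eval-scale a V)) (sym (distribˡ a _ _))

    eval-*ˡ : ∀ {g : A → Carrier} x V → eval (λ p → x * g p) V ≈ x * eval g V
    eval-*ˡ x []            = sym (zeroʳ x)
    eval-*ˡ x ((a , p) ∷ V) =
      trans (+-cong (x∙yz≈y∙xz a x _) (eval-*ˡ x V)) (sym (distribˡ x _ _))

    eval-*ʳ : ∀ {g : A → Carrier} x V → eval (λ p → g p * x) V ≈ eval g V * x
    eval-*ʳ x []            = sym (zeroˡ x)
    eval-*ʳ x ((a , p) ∷ V) =
      trans (+-cong (sym (*-assoc a _ x)) (eval-*ʳ x V)) (sym (distribʳ x _ _))

    eval-filter : ∀ {g : A → Carrier} (b : A → Bool) V →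
                  eval g (filter (λ e → T? (b (proj₂ e))) V) ≈ eval (λ p → if b p then g p else 0#) V
    eval-filter b []            = refl
    eval-filter b ((a , p) ∷ V) with b p
    ... | true  = +-cong refl (eval-filter b V)
    ... | false = trans (eval-filter b V) (sym (trans (+-cong (zeroʳ a) refl) (+-identityˡ _)))

  eval-ext : ∀ {A B : Set} {g : B → Carrier} (f : A → Lin B) V →
             eval g (ext f V) ≈ eval (λ p → eval g (f p)) V
  eval-ext f []            = refl
  eval-ext f ((a , p) ∷ V) =
    trans (eval-++ (scale a (f p)) (ext f V)) (+-cong (eval-scale a (f p)) (eval-ext f V))

  ∑ : {A : Set} → List A → (A → Carrier) → Carrier
  ∑ []       h = 0#
  ∑ (k ∷ ks) h = h k + ∑ ks h

  module _ {A : Set} where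

    ∑-zero : ∀ {h : A → Carrier} {ks} → All (λ q → h q ≈ 0#) ks → ∑ ks h ≈ 0#
    ∑-zero []           = refl
    ∑-zero (h≈0 ∷ hs≈0) = trans (+-cong h≈0 (∑-zero hs≈0)) (+-identityʳ 0#)

    ∑-cong : ∀ {h h′ : A → Carrier} ks → (∀ q → h q ≈ h′ q) → ∑ ks h ≈ ∑ ks h′
    ∑-cong []       h≈h′ = refl
    ∑-cong (k ∷ ks) h≈h′ = +-cong (h≈h′ k) (∑-cong ks h≈h′)

    ∑-+ : ∀ (h h′ : A → Carrier) ks → ∑ ks (λ q → h q + h′ q) ≈ ∑ ks h + ∑ ks h′
    ∑-+ h h′ []       = sym (+-identityʳ 0#)
    ∑-+ h h′ (k ∷ ks) = trans (+-cong refl (∑-+ h h′ ks)) (interchange _ _ _ _)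

  if-then-0 : ∀ b {x} → x ≈ 0# → (if b then x else 0#) ≈ 0#
  if-then-0 true  x≈0 = x≈0
  if-then-0 false _   = refl

  SupportedOn : {A : Set} → (A → Set) → (A → Carrier) → Set ℓ
  SupportedOn Z g = ∀ q → Z q ⊎ g q ≈ 0#

  module Coefficients {A : Set} (_≟_ : DecidableEquality A) where

    kronecker : A → A → Carrier
    kronecker p q = if does (p ≟ q) then 1# else 0#

    if-≡ : ∀ {a} p → (if does (p ≟ p) then a else 0#) ≡ a
    if-≡ p rewrite dec-true (p ≟ p) ≡.refl = ≡.refl

    if-≢ : ∀ {a p q} → p ≢ q → (if does (p ≟ q) then a else 0#) ≡ 0#
    if-≢ {p = p} {q} p≢q rewrite dec-false (p ≟ q) p≢q = ≡.refl

    coeff≈eval : ∀ V r → coeff _≟_ V r ≈ eval (λ p → kronecker p r) V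
    coeff≈eval []            r = refl
    coeff≈eval ((a , p) ∷ V) r with does (p ≟ r)
    ... | true  = +-cong (sym (*-identityʳ a)) (coeff≈eval V r)
    ... | false = +-cong (sym (zeroʳ a)) (coeff≈eval V r)

    coeff-single : ∀ a x r → coeff _≟_ ((a , x) ∷ []) r ≈ a * kronecker x r
    coeff-single a x r = trans (coeff≈eval ((a , x) ∷ []) r) (+-identityʳ _)

    coeff-∷-≢ : ∀ {a x r} V → x ≢ r → coeff _≟_ ((a , x) ∷ V) r ≈ coeff _≟_ V r
    coeff-∷-≢ V x≢r = trans (+-cong (reflexive (if-≢ x≢r)) refl) (+-identityˡ _)

    coeff-∉ : ∀ {r} V → All (λ e → proj₂ e ≢ r) V → coeff _≟_ V r ≈ 0#
    coeff-∉ []            []          = refl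
    coeff-∉ ((a , p) ∷ V) (p≢r ∷ V∌r) = trans (coeff-∷-≢ V p≢r) (coeff-∉ V V∌r)

    coeff-ext : ∀ {B : Set} (f : B → Lin A) V r →
                coeff _≟_ (ext f V) r ≈ eval (λ b → coeff _≟_ (f b) r) V
    coeff-ext f V r = begin
      coeff _≟_ (ext f V) r                           ≈⟨ coeff≈eval (ext f V) r ⟩
      eval (λ p → kronecker p r) (ext f V)            ≈⟨ eval-ext f V ⟩
      eval (λ b → eval (λ p → kronecker p r) (f b)) V ≈⟨ eval-cong V (λ b → sym (coeff≈eval (f b) r)) ⟩
      eval (λ b → coeff _≟_ (f b) r) V                ∎

    coeff-ext-single : ∀ {B : Set} (f : B → Lin A) p r →
                       coeff _≟_ (ext f ((1# , p) ∷ [])) r ≈ coeff _≟_ (f p) r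
    coeff-ext-single f p r =
      trans (coeff-ext f ((1# , p) ∷ []) r) (trans (+-identityʳ _) (*-identityˡ _))

    ∑-pick : ∀ {g : A → Carrier} {a p ks} → Unique ks → p ∈ ks →
             ∑ ks (λ q → (if does (p ≟ q) then a else 0#) * g q) ≈ a * g p
    ∑-pick {g} {a} {p} (p∉ks ∷ _) (here ≡.refl) = begin
      (if does (p ≟ p) then a else 0#) * g p + _
        ≈⟨ +-cong (*-cong (reflexive (if-≡ p)) refl) (∑-zero (All.map vanish p∉ks)) ⟩
      a * g p + 0#
        ≈⟨ +-identityʳ _ ⟩
      a * g p
        ∎
      where
        vanish : ∀ {q} → p ≢ q → (if does (p ≟ q) then a else 0#) * g q ≈ 0#
        vanish p≢q = trans (*-cong (reflexive (if-≢ p≢q)) refl) (zeroˡ _)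
    ∑-pick {g} {a} {p} {k ∷ _} (k∉ks ∷ Uks) (there p∈ks) =
      trans (+-cong (trans (*-cong (reflexive (if-≢ p≢k)) refl) (zeroˡ _)) (∑-pick Uks p∈ks))
            (+-identityˡ _)
      where
        p≢k : p ≢ k
        p≢k p≡k = All.lookup k∉ks p∈ks (≡.sym p≡k)

    eval≈∑coeff : ∀ {g : A → Carrier} {ks} → Unique ks → ∀ V → map proj₂ V ⊆ ks →
                  eval g V ≈ ∑ ks (λ q → coeff _≟_ V q * g q)
    eval≈∑coeff {g} {ks} Uks []            _    = sym (∑-zero (All.universal (λ q → zeroˡ (g q)) ks))
    eval≈∑coeff {g} {ks} Uks ((a , p) ∷ V) V⊆ks = begin
      a * g p + eval g V
        ≈⟨ +-cong (sym (∑-pick Uks (V⊆ks (here ≡.refl)))) (eval≈∑coeff Uks V (V⊆ks ∘ there)) ⟩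
      ∑ ks (λ q → (if does (p ≟ q) then a else 0#) * g q) + ∑ ks (λ q → coeff _≟_ V q * g q)
        ≈⟨ sym (∑-+ _ _ ks) ⟩
      ∑ ks (λ q → (if does (p ≟ q) then a else 0#) * g q + coeff _≟_ V q * g q)
        ≈⟨ ∑-cong ks (λ q → sym (distribʳ (g q) _ _)) ⟩
      ∑ ks (λ q → coeff _≟_ ((a , p) ∷ V) q * g q)
        ∎

    -- A record rather than a function type, so that V and W can be inferred by unification.
    record AgreeOn (Z : A → Set) (V W : Lin A) : Set ℓ where
      constructor agreeOn
      field agree : ∀ q → Z q → coeff _≟_ V q ≈ coeff _≟_ W q
    open AgreeOn public

    eval-resp-on : ∀ {Z} {g : A → Carrier} {V W} → SupportedOn Z g → AgreeOn Z V W →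
                   eval g V ≈ eval g W
    eval-resp-on {g = g} {V} {W} g-on-Z V≈W = begin
      eval g V                         ≈⟨ eval≈∑coeff Uks V (∈-deduplicate⁺ _≟_ ∘ ∈-++⁺ˡ) ⟩
      ∑ ks (λ q → coeff _≟_ V q * g q) ≈⟨ ∑-cong ks termwise ⟩
      ∑ ks (λ q → coeff _≟_ W q * g q) ≈⟨ sym (eval≈∑coeff Uks W (∈-deduplicate⁺ _≟_ ∘ ∈-++⁺ʳ _)) ⟩
      eval g W                         ∎
      where
        ks : List A
        ks = deduplicate _≟_ (map proj₂ V ++ map proj₂ W)
        Uks : Unique ks
        Uks = UniqueDec.deduplicate-! _≟_ _
        termwise : ∀ q → coeff _≟_ V q * g q ≈ coeff _≟_ W q * g q
        termwise q with g-on-Z q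
        ... | inj₁ Zq   = *-cong (agree V≈W q Zq) refl
        ... | inj₂ gq≈0 = trans (annihilated (coeff _≟_ V q)) (sym (annihilated (coeff _≟_ W q)))
          where
            annihilated : ∀ x → x * g q ≈ 0#
            annihilated x = trans (*-cong refl gq≈0) (zeroʳ x)

    module _ {Z : A → Set} where

      AgreeOn-refl : ∀ {V} → AgreeOn Z V V
      AgreeOn-refl = agreeOn λ _ _ → refl

      AgreeOn-sym : ∀ {V W} → AgreeOn Z V W → AgreeOn Z W V
      AgreeOn-sym V≈W = agreeOn λ q Zq → sym (agree V≈W q Zq)

      AgreeOn-trans : ∀ {U V W} → AgreeOn Z U V → AgreeOn Z V W → AgreeOn Z U W
      AgreeOn-trans U≈V V≈W = agreeOn λ q Zq → trans (agree U≈V q Zq) (agree V≈W q Zq)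

      AgreeOn-setoid : Setoid c ℓ
      AgreeOn-setoid = record
        { Carrier       = Lin A
        ; _≈_           = AgreeOn Z
        ; isEquivalence = record { refl = AgreeOn-refl ; sym = AgreeOn-sym ; trans = AgreeOn-trans }
        }

      EqV⇒AgreeOn : ∀ {V W} → EqV _≟_ V W → AgreeOn Z V W
      EqV⇒AgreeOn V≈W = agreeOn λ q _ → V≈W q

      AgreeOn-∷ : ∀ {a b x V W} → a ≈ b → AgreeOn Z V W → AgreeOn Z ((a , x) ∷ V) ((b , x) ∷ W)
      AgreeOn-∷ {a} {b} {x} {V} {W} a≈b V≈W = agreeOn cons
        where
          cons : ∀ q → Z q → coeff _≟_ ((a , x) ∷ V) q ≈ coeff _≟_ ((b , x) ∷ W) q
          cons q Zq with does (x ≟ q)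
          ... | true  = +-cong a≈b (agree V≈W q Zq)
          ... | false = +-cong refl (agree V≈W q Zq)

      AgreeOn-drop : ∀ {a x V} → ¬ Z x → AgreeOn Z ((a , x) ∷ V) V
      AgreeOn-drop {V = V} ¬Zx = agreeOn λ q Zq → coeff-∷-≢ V λ { ≡.refl → ¬Zx Zq }

      eval-on-single : ∀ {g : A → Carrier} {V x} → SupportedOn Z g → AgreeOn Z V ((1# , x) ∷ []) →
                       eval g V ≈ g x
      eval-on-single g-on-Z V≈x =
        trans (eval-resp-on g-on-Z V≈x) (trans (+-identityʳ _) (*-identityˡ _))

      ext-resp-on : ∀ (f : A → Lin A) {V W} → (∀ r → Z r → SupportedOn Z (λ p → coeff _≟_ (f p) r)) →
                    AgreeOn Z V W → AgreeOn Z (ext f V) (ext f W)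
      ext-resp-on f {V} {W} f-on-Z V≈W = agreeOn λ r Zr →
        trans (coeff-ext f V r) (trans (eval-resp-on (f-on-Z r Zr) V≈W) (sym (coeff-ext f W r)))

      ext-cong-on : ∀ {f g : A → Lin A} V → (∀ p → AgreeOn Z (f p) (g p)) →
                    AgreeOn Z (ext f V) (ext g V)
      ext-cong-on {f} {g} V f≈g = agreeOn λ r Zr →
        trans (coeff-ext f V r) (trans (eval-cong V (λ p → agree (f≈g p) r Zr)) (sym (coeff-ext g V r)))

  open Coefficients using (kronecker)

  kronecker-× : ∀ {A B : Set} (_≟A_ : DecidableEquality A) (_≟B_ : DecidableEquality B)
                (_≟_ : DecidableEquality (A × B)) a b c d →
                kronecker _≟_ (a , b) (c , d) ≈ kronecker _≟A_ a c * kronecker _≟B_ b d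
  kronecker-× _≟A_ _≟B_ _≟_ a b c d with a ≟A c | b ≟B d
  ... | yes ≡.refl | yes ≡.refl rewrite dec-true ((a , b) ≟ (a , b)) ≡.refl = sym (*-identityʳ 1#)
  ... | no a≢c     | _      rewrite dec-false ((a , b) ≟ (c , d)) (a≢c ∘ ≡.cong proj₁) = sym (zeroˡ _)
  ... | yes _      | no b≢d rewrite dec-false ((a , b) ≟ (c , d)) (b≢d ∘ ≡.cong proj₂) = sym (zeroʳ _)

module Forests {c ℓ} (K : Field c ℓ) (w : Field.Carrier K) where
  open Field K
  open ADF K w
  open LinearCombinations K
  open Coefficients
  open SetoidReasoning setoid

  -- R2 V is definitionally ext R2-basis V.
  R2-basis : Forest × Forest → Lin (Forest × Forest)
  R2-basis p = (1# , (rootF (proj₁ p) , proj₂ p)) ∷ (ε (proj₁ p) , (unitF , rootF (proj₂ p))) ∷ []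

  coeff₁ : Lin Forest → Forest → Carrier
  coeff₁ = coeff _≟F_

  coeff₂ : Lin (Forest × Forest) → Forest × Forest → Carrier
  coeff₂ = coeff _≟F2_

  ε-nonunit : ∀ H → H ≢ unitF → ε H ≡ 0#
  ε-nonunit (• ∣ [])      H≢unit = ⊥-elim (H≢unit ≡.refl)
  ε-nonunit (• ∣ (_ ∷ _)) _      = ≡.refl
  ε-nonunit (B⁺ _ ∣ _)    _      = ≡.refl

  coeff-ε-nonunit : ∀ {A : Set} (_≟_ : DecidableEquality A) {H} x r → H ≢ unitF →
                    coeff _≟_ ((ε H , x) ∷ []) r ≈ 0#
  coeff-ε-nonunit _≟_ {H} x r H≢unit =
    trans (coeff-single _≟_ (ε H) x r) (trans (*-cong (reflexive (ε-nonunit H H≢unit)) refl) (zeroˡ _))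

  lmap-avoids : ∀ {A B : Set} (f : A → B) {r} → (∀ p → f p ≢ r) → ∀ V →
                All (λ e → proj₂ e ≢ r) (lmap f V)
  lmap-avoids f f≢r []            = []
  lmap-avoids f f≢r ((_ , p) ∷ V) = f≢r p ∷ lmap-avoids f f≢r V

  tp-avoids-• : ∀ T T′ → T ≢ • ⊎ T′ ≢ • → All (λ e → proj₂ e ≢ •) (tp T T′)
  tp-avoids-• • • (inj₁ •≢•) = ⊥-elim (•≢• ≡.refl)
  tp-avoids-• • • (inj₂ •≢•) = ⊥-elim (•≢• ≡.refl)
  tp-avoids-• • (B⁺ _) _ = (λ ()) ∷ []
  tp-avoids-• (B⁺ (_ ∣ _)) • _ = (λ ()) ∷ []
  tp-avoids-• (B⁺ (T ∣ l)) (B⁺ (T′ ∣ l′)) _ =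
    AllP.++⁺ (B⁺-avoids (merge (B⁺ (T ∣ l)) [] T′ l′))
      (AllP.++⁺ (B⁺-avoids (merge T l (B⁺ (T′ ∣ l′)) [])) (AllP.map⁺ (B⁺-avoids (merge T l T′ l′))))
    where
      B⁺-avoids : ∀ V → All (λ e → proj₂ e ≢ •) (lmap B⁺ V)
      B⁺-avoids = lmap-avoids B⁺ (λ _ ())

  ⋄-avoids-unit : ∀ P Q → P ≢ unitF ⊎ Q ≢ unitF → All (λ e → proj₂ e ≢ unitF) (P ⋄ Q)
  ⋄-avoids-unit (T ∣ (_ ∷ l)) (T′ ∣ l′) _ = lmap-avoids _ (λ { (_ ∣ _) () }) _
  ⋄-avoids-unit (T ∣ []) (T′ ∣ (_ ∷ _)) _ = lmap-avoids _ (λ _ ()) (tp T T′)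
  ⋄-avoids-unit (T ∣ []) (T′ ∣ []) P≢unit⊎Q≢unit =
    AllP.map⁺ (All.map (_∘ ≡.cong root-tree) (tp-avoids-• T T′ T≢•⊎T′≢•))
    where
      root-tree : Forest → Tree
      root-tree (t ∣ _) = t
      T≢•⊎T′≢• : T ≢ • ⊎ T′ ≢ •
      T≢•⊎T′≢• = Sum.map (_∘ ≡.cong (_∣ [])) (_∘ ≡.cong (_∣ [])) P≢unit⊎Q≢unit

  coeff-⋄-unit : ∀ P Q → P ≢ unitF ⊎ Q ≢ unitF → coeff₁ (P ⋄ Q) unitF ≈ 0#
  coeff-⋄-unit P Q P≢unit⊎Q≢unit = coeff-∉ _≟F_ (P ⋄ Q) (⋄-avoids-unit P Q P≢unit⊎Q≢unit)

  coeff-⊗ : ∀ V W G H → coeff₂ (V ⊗ W) (G , H) ≈ coeff₁ V G * coeff₁ W H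
  coeff-⊗ V W G H = begin
    coeff₂ (V ⊗ W) (G , H)
      ≈⟨ coeff-ext _≟F2_ (λ a → ext (λ b → (1# , (a , b)) ∷ []) W) V (G , H) ⟩
    eval (λ a → coeff₂ (ext (λ b → (1# , (a , b)) ∷ []) W) (G , H)) V
      ≈⟨ eval-cong V (λ a → coeff-ext _≟F2_ (λ b → (1# , (a , b)) ∷ []) W (G , H)) ⟩
    eval (λ a → eval (λ b → coeff₂ ((1# , (a , b)) ∷ []) (G , H)) W) V
      ≈⟨ eval-cong V (λ a → eval-cong W (λ b → pair a b)) ⟩
    eval (λ a → eval (λ b → kronecker _≟F_ a G * kronecker _≟F_ b H) W) V
      ≈⟨ eval-cong V (λ a → eval-*ˡ _ W) ⟩
    eval (λ a → kronecker _≟F_ a G * eval (λ b → kronecker _≟F_ b H) W) V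
      ≈⟨ eval-*ʳ _ V ⟩
    eval (λ a → kronecker _≟F_ a G) V * eval (λ b → kronecker _≟F_ b H) W
      ≈⟨ *-cong (sym (coeff≈eval _≟F_ V G)) (sym (coeff≈eval _≟F_ W H)) ⟩
    coeff₁ V G * coeff₁ W H
      ∎
    where
      pair : ∀ a b → coeff₂ ((1# , (a , b)) ∷ []) (G , H) ≈ kronecker _≟F_ a G * kronecker _≟F_ b H
      pair a b = trans (coeff-single _≟F2_ 1# (a , b) (G , H))
                       (trans (*-identityˡ _) (kronecker-× _≟F_ _≟F_ _≟F2_ a b G H))

  -- L ⋆ M is definitionally ext (λ p → ext (p ∙_) M) L.
  _∙_ : Forest × Forest → Forest × Forest → Lin (Forest × Forest)
  p ∙ q = (proj₁ p ⋄ proj₁ q) ⊗ (proj₂ p ⋄ proj₂ q)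

  module _ {Z : Forest × Forest → Set} (Z? : Decidable Z)
           (∙-vanishes : ∀ p q r → Z r → ¬ Z p ⊎ ¬ Z q → coeff₂ (p ∙ q) r ≈ 0#) where

    AgreeOn-⋆ : ∀ {L L′ M M′} → AgreeOn _≟F2_ Z L L′ → AgreeOn _≟F2_ Z M M′ →
                AgreeOn _≟F2_ Z (L ⋆ M) (L′ ⋆ M′)
    AgreeOn-⋆ {L} {L′} {M} {M′} L≈L′ M≈M′ =
      AgreeOn-trans _≟F2_ (ext-resp-on _≟F2_ (λ p → ext (p ∙_) M) outer L≈L′)
                          (ext-cong-on _≟F2_ L′ (λ p → ext-resp-on _≟F2_ (p ∙_) (inner p) M≈M′))
      where
        inner : ∀ p r → Z r → SupportedOn Z (λ q → coeff₂ (p ∙ q) r)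
        inner p r Zr q with Z? q
        ... | yes Zq = inj₁ Zq
        ... | no ¬Zq = inj₂ (∙-vanishes p q r Zr (inj₂ ¬Zq))
        outer : ∀ r → Z r → SupportedOn Z (λ p → coeff₂ (ext (p ∙_) M) r)
        outer r Zr p with Z? p
        ... | yes Zp = inj₁ Zp
        ... | no ¬Zp = inj₂ (trans (coeff-ext _≟F2_ (p ∙_) M r)
                                   (eval-zero M (λ q → ∙-vanishes p q r Zr (inj₁ ¬Zp))))

  ⋆-single : ∀ p q {F F′} →
             proj₁ p ⋄ proj₁ q ≡ (1# , F) ∷ [] → proj₂ p ⋄ proj₂ q ≡ (1# , F′) ∷ [] →
             (((1# , p) ∷ []) ⋆ ((1# , q) ∷ [])) ≈₂ ((1# , (F , F′)) ∷ [])
  ⋆-single (A , A′) (B , B′) {F} {F′} A⋄B≡F A′⋄B′≡F′ r = begin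
    coeff₂ (((1# , (A , A′)) ∷ []) ⋆ ((1# , (B , B′)) ∷ [])) r
      ≈⟨ coeff-ext-single _≟F2_ (λ p → ext (p ∙_) ((1# , (B , B′)) ∷ [])) (A , A′) r ⟩
    coeff₂ (ext ((A , A′) ∙_) ((1# , (B , B′)) ∷ [])) r
      ≈⟨ coeff-ext-single _≟F2_ ((A , A′) ∙_) (B , B′) r ⟩
    coeff₂ ((A ⋄ B) ⊗ (A′ ⋄ B′)) r
      ≡⟨ ≡.cong₂ (λ V W → coeff₂ (V ⊗ W) r) A⋄B≡F A′⋄B′≡F′ ⟩
    coeff₂ (((1# , F) ∷ []) ⊗ ((1# , F′) ∷ [])) r
      ≈⟨ coeff-ext-single _≟F2_ (λ a → ext (λ b → (1# , (a , b)) ∷ []) ((1# , F′) ∷ [])) F r ⟩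
    coeff₂ (ext (λ b → (1# , (F , b)) ∷ []) ((1# , F′) ∷ [])) r
      ≈⟨ coeff-ext-single _≟F2_ (λ b → (1# , (F , b)) ∷ []) F′ r ⟩
    coeff₂ ((1# , (F , F′)) ∷ []) r
      ∎

  ⋄-dot : ∀ T x → (T ∣ []) ⋄ dot x ≡ (1# , T ∣ ((x , •) ∷ [])) ∷ []
  ⋄-dot •            x = ≡.refl
  ⋄-dot (B⁺ (_ ∣ _)) x = ≡.refl

  -- A forest T x T₂ ⋯ is (T ⋄ • x •) ⋄ (T₂ ⋯) and a tree B⁺ F is R(F): ADF is generated by the • x •.
  module _ {p} (C : Forest → Set p)
           (C-unit : C unitF)
           (C-dot  : ∀ x → C (dot x))
           (C-root : ∀ F → Unique (labelsF F) → C F → C (rootF F))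
           (C-⋄    : ∀ {A B F} → A ⋄ B ≡ (1# , F) ∷ [] →
                     Unique (labelsF A) → Unique (labelsF B) → Disjoint (labelsF A) (labelsF B) →
                     C A → C B → C F) where

    forest-induction : ∀ F → Unique (labelsF F) → C F
    tree-induction   : ∀ T → Unique (labelsT T) → C (T ∣ [])
    spine-induction  : ∀ T l → C (T ∣ []) → Unique (labelsF (T ∣ l)) → C (T ∣ l)

    forest-induction (T ∣ l) U = spine-induction T l (tree-induction T (proj₁ (Unique-++⁻ (labelsT T) U))) U

    tree-induction •      _ = C-unit
    tree-induction (B⁺ F) U = C-root F U (forest-induction F U)

    spine-induction T []             C-T _ = C-T
    spine-induction T ((x , T₂) ∷ l) C-T U
      with Unique-split-at (labelsT T) x (labelsT T₂ ++ labelsL l) U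
    ... | U₁ , U₂ , disj with Unique-split-last (labelsT T) x U₁
    ... | U₀ , Uₓ , disj₀ =
      C-⋄ ≡.refl U₁ U₂ disj
        (C-⋄ (⋄-dot T x) U₀ Uₓ disj₀ C-T (C-dot x))
        (spine-induction T₂ l (tree-induction T₂ (proj₁ (Unique-++⁻ (labelsT T₂) U₂))) U₂)

module CounitLaws {c ℓ} (K : Field c ℓ) (w : Field.Carrier K)
                  (δ : Forest → Lin.Lin K (Forest × Forest)) (isΔ : ADF.IsΔ K w δ) where
  open Field K
  open ADF K w
  open LinearCombinations K
  open Forests K w
  open Coefficients _≟F2_
  open IsΔ isΔ

  δ-⋄ : ∀ {A B F} → A ⋄ B ≡ (1# , F) ∷ [] →
        Unique (labelsF A) → Unique (labelsF B) → Disjoint (labelsF A) (labelsF B) →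
        δ F ≈₂ (δ A ⋆ δ B)
  δ-⋄ {A} {B} {F} A⋄B≡F UA UB A#B r = begin
    coeff₂ (δ F) r                  ≈⟨ sym (coeff-ext-single δ F r) ⟩
    coeff₂ (Δ̂ δ ((1# , F) ∷ [])) r  ≡⟨ ≡.cong (λ V → coeff₂ (Δ̂ δ V) r) A⋄B≡F ⟨
    coeff₂ (Δ̂ δ (A ⋄ B)) r          ≈⟨ mult A B UA UB A#B r ⟩
    coeff₂ (δ A ⋆ δ B) r            ∎
    where open SetoidReasoning setoid

  In⊗• In•⊗ : Forest × Forest → Set
  In⊗• p = proj₂ p ≡ unitF
  In•⊗ p = proj₁ p ≡ unitF

  _⊗• •⊗_ : Forest → Lin (Forest × Forest)
  F ⊗• = (1# , (F , unitF)) ∷ []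
  •⊗ F = (1# , (unitF , F)) ∷ []

  ∙-vanishes-⊗• : ∀ p q r → In⊗• r → ¬ In⊗• p ⊎ ¬ In⊗• q → coeff₂ (p ∙ q) r ≈ 0#
  ∙-vanishes-⊗• p q (G , _) ≡.refl p∉⊎q∉ =
    trans (coeff-⊗ (proj₁ p ⋄ proj₁ q) (proj₂ p ⋄ proj₂ q) G unitF)
          (trans (*-cong refl (coeff-⋄-unit (proj₂ p) (proj₂ q) p∉⊎q∉)) (zeroʳ _))

  ∙-vanishes-•⊗ : ∀ p q r → In•⊗ r → ¬ In•⊗ p ⊎ ¬ In•⊗ q → coeff₂ (p ∙ q) r ≈ 0#
  ∙-vanishes-•⊗ p q (_ , G) ≡.refl p∉⊎q∉ =
    trans (coeff-⊗ (proj₁ p ⋄ proj₁ q) (proj₂ p ⋄ proj₂ q) unitF G)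
          (trans (*-cong (coeff-⋄-unit (proj₁ p) (proj₁ q) p∉⊎q∉) refl) (zeroˡ _))

  R2-supported-⊗• : ∀ r → In⊗• r → SupportedOn In⊗• (λ p → coeff₂ (R2-basis p) r)
  R2-supported-⊗• (G , _) ≡.refl (P , Q) with Q ≟F unitF
  ... | yes Q≡unit = inj₁ Q≡unit
  ... | no  Q≢unit = inj₂ (coeff-∉ {r = G , unitF} (R2-basis (P , Q))
                             ((Q≢unit ∘ ≡.cong proj₂) ∷ ((λ ()) ∘ ≡.cong proj₂) ∷ []))

  R2-supported-•⊗ : ∀ r → In•⊗ r → SupportedOn In•⊗ (λ p → coeff₂ (R2-basis p) r)
  R2-supported-•⊗ (_ , G) ≡.refl (P , Q) with P ≟F unitF
  ... | yes P≡unit = inj₁ P≡unit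
  ... | no  P≢unit = inj₂ (trans (coeff-∷-≢ {1#} ((ε P , (unitF , rootF Q)) ∷ []) root≢unit)
                                 (coeff-ε-nonunit _≟F2_ (unitF , rootF Q) (unitF , G) P≢unit))
    where
      root≢unit : (rootF P , Q) ≢ (unitF , G)
      root≢unit = (λ ()) ∘ ≡.cong proj₁

  Counital-⊗• Counital-•⊗ : Forest → Set ℓ
  Counital-⊗• F = AgreeOn In⊗• (δ F) (F ⊗•)
  Counital-•⊗ F = AgreeOn In•⊗ (δ F) (•⊗ F)

  counital-⊗• : ∀ F → Unique (labelsF F) → Counital-⊗• F
  counital-⊗• = forest-induction Counital-⊗• (EqV⇒AgreeOn unit) dot-case root-case ⋄-case
    where
      open SetoidReasoning (AgreeOn-setoid {In⊗•})
      dot-case : ∀ x → Counital-⊗• (dot x)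
      dot-case x = begin
        δ (dot x)                                               ≈⟨ EqV⇒AgreeOn (gen x) ⟩
        (1# , (dot x , unitF)) ∷ (1# , (unitF , dot x)) ∷ []    ≈⟨ AgreeOn-∷ refl (AgreeOn-drop λ ()) ⟩
        dot x ⊗•                                                ∎
      root-case : ∀ F → Unique (labelsF F) → Counital-⊗• F → Counital-⊗• (rootF F)
      root-case F UF δF≈F = begin
        δ (rootF F)      ≈⟨ EqV⇒AgreeOn (oper F UF) ⟩
        R2 (δ F)         ≈⟨ ext-resp-on R2-basis R2-supported-⊗• δF≈F ⟩
        R2 (F ⊗•)        ≈⟨ AgreeOn-∷ (*-identityˡ 1#) (AgreeOn-drop λ ()) ⟩
        rootF F ⊗•       ∎
      ⋄-case : ∀ {A B F} → A ⋄ B ≡ (1# , F) ∷ [] →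
               Unique (labelsF A) → Unique (labelsF B) → Disjoint (labelsF A) (labelsF B) →
               Counital-⊗• A → Counital-⊗• B → Counital-⊗• F
      ⋄-case {A} {B} {F} A⋄B≡F UA UB A#B δA≈A δB≈B = begin
        δ F                  ≈⟨ EqV⇒AgreeOn (δ-⋄ A⋄B≡F UA UB A#B) ⟩
        δ A ⋆ δ B            ≈⟨ AgreeOn-⋆ (λ p → proj₂ p ≟F unitF) ∙-vanishes-⊗• δA≈A δB≈B ⟩
        (A ⊗•) ⋆ (B ⊗•)      ≈⟨ EqV⇒AgreeOn (⋆-single (A , unitF) (B , unitF) A⋄B≡F ≡.refl) ⟩
        F ⊗•                 ∎

  counital-•⊗ : ∀ F → Unique (labelsF F) → Counital-•⊗ F
  counital-•⊗ = forest-induction Counital-•⊗ (EqV⇒AgreeOn unit) dot-case root-case ⋄-case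
    where
      open SetoidReasoning (AgreeOn-setoid {In•⊗})
      dot-case : ∀ x → Counital-•⊗ (dot x)
      dot-case x = begin
        δ (dot x)                                               ≈⟨ EqV⇒AgreeOn (gen x) ⟩
        (1# , (dot x , unitF)) ∷ (1# , (unitF , dot x)) ∷ []    ≈⟨ AgreeOn-drop (λ ()) ⟩
        •⊗ dot x                                                ∎
      root-case : ∀ F → Unique (labelsF F) → Counital-•⊗ F → Counital-•⊗ (rootF F)
      root-case F UF δF≈F = begin
        δ (rootF F)      ≈⟨ EqV⇒AgreeOn (oper F UF) ⟩
        R2 (δ F)         ≈⟨ ext-resp-on R2-basis R2-supported-•⊗ δF≈F ⟩
        R2 (•⊗ F)        ≈⟨ AgreeOn-drop (λ ()) ⟩
        (1# * 1# , (unitF , rootF F)) ∷ []  ≈⟨ AgreeOn-∷ (*-identityˡ 1#) AgreeOn-refl ⟩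
        •⊗ rootF F       ∎
      ⋄-case : ∀ {A B F} → A ⋄ B ≡ (1# , F) ∷ [] →
               Unique (labelsF A) → Unique (labelsF B) → Disjoint (labelsF A) (labelsF B) →
               Counital-•⊗ A → Counital-•⊗ B → Counital-•⊗ F
      ⋄-case {A} {B} {F} A⋄B≡F UA UB A#B δA≈A δB≈B = begin
        δ F                  ≈⟨ EqV⇒AgreeOn (δ-⋄ A⋄B≡F UA UB A#B) ⟩
        δ A ⋆ δ B            ≈⟨ AgreeOn-⋆ (λ p → proj₁ p ≟F unitF) ∙-vanishes-•⊗ δA≈A δB≈B ⟩
        (•⊗ A) ⋆ (•⊗ B)      ≈⟨ EqV⇒AgreeOn (⋆-single (unitF , A) (unitF , B) ≡.refl A⋄B≡F) ⟩
        •⊗ F                 ∎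

  selected : List ℕ → List ℕ → (Forest × Forest → Lin Forest) → Forest → Forest × Forest → Carrier
  selected X₁ X₂ φ G p = if selects X₁ X₂ p then coeff₁ (φ p) G else 0#

  module _ (X : List ℕ) (UX : Unique X) where

    eval-Δ̂-on : ∀ {Z g} (ι : Forest → Forest × Forest) → SupportedOn Z g →
                (∀ F → Unique (labelsF F) → AgreeOn Z (δ F) ((1# , ι F) ∷ [])) →
                ∀ v → All (λ e → labelsF (proj₂ e) ↭ X) v → eval g (Δ̂ δ v) ≈ eval (g ∘ ι) v
    eval-Δ̂-on ι g-on-Z counital v v⊆X =
      trans (eval-ext δ v)
            (eval-cong-All v⊆X λ F F↭X → eval-on-single g-on-Z (counital F (Unique-resp-↭ (↭-sym F↭X) UX)))

    counit-law : ∀ {Z} (ι : Forest → Forest × Forest) (φ : Forest × Forest → Lin Forest) X₁ X₂ →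
                 (∀ F → Unique (labelsF F) → AgreeOn Z (δ F) ((1# , ι F) ∷ [])) →
                 (∀ G → SupportedOn Z (selected X₁ X₂ φ G)) →
                 (∀ F G → labelsF F ↭ X → selected X₁ X₂ φ G (ι F) ≈ Coefficients.kronecker _≟F_ F G) →
                 ∀ v → All (λ e → labelsF (proj₂ e) ↭ X) v → ext φ (proj X₁ X₂ (Δ̂ δ v)) ≈F v
    counit-law ι φ X₁ X₂ counital supported at-ι v v⊆X G = begin
      coeff₁ (ext φ (proj X₁ X₂ (Δ̂ δ v))) G
        ≈⟨ Coefficients.coeff-ext _≟F_ φ (proj X₁ X₂ (Δ̂ δ v)) G ⟩
      eval (λ p → coeff₁ (φ p) G) (proj X₁ X₂ (Δ̂ δ v))
        ≈⟨ eval-filter (selects X₁ X₂) (Δ̂ δ v) ⟩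
      eval (selected X₁ X₂ φ G) (Δ̂ δ v)
        ≈⟨ eval-Δ̂-on ι (supported G) counital v v⊆X ⟩
      eval (selected X₁ X₂ φ G ∘ ι) v
        ≈⟨ eval-cong-All v⊆X (λ F F↭X → at-ι F G F↭X) ⟩
      eval (λ F → Coefficients.kronecker _≟F_ F G) v
        ≈⟨ sym (Coefficients.coeff≈eval _≟F_ v G) ⟩
      coeff₁ v G
        ∎
      where open SetoidReasoning setoid

    counit-⊗• : ∀ v → All (λ e → labelsF (proj₂ e) ↭ X) v → id⊗ε (proj X [] (Δ̂ δ v)) ≈F v
    counit-⊗• = counit-law (_, unitF) φ X [] counital-⊗• supported at-unit
      where
        φ : Forest × Forest → Lin Forest
        φ p = (ε (proj₂ p) , proj₁ p) ∷ []
        supported : ∀ G → SupportedOn In⊗• (selected X [] φ G)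
        supported G (P , Q) with Q ≟F unitF
        ... | yes Q≡unit = inj₁ Q≡unit
        ... | no  Q≢unit = inj₂ (if-then-0 (selects X [] (P , Q)) (coeff-ε-nonunit _≟F_ P G Q≢unit))
        at-unit : ∀ F G → labelsF F ↭ X → selected X [] φ G (F , unitF) ≈ Coefficients.kronecker _≟F_ F G
        at-unit F G F↭X rewrite sameLabels-↭ F↭X = +-identityʳ _

    counit-•⊗ : ∀ v → All (λ e → labelsF (proj₂ e) ↭ X) v → ε⊗id (proj [] X (Δ̂ δ v)) ≈F v
    counit-•⊗ = counit-law (unitF ,_) φ [] X counital-•⊗ supported at-unit
      where
        φ : Forest × Forest → Lin Forest
        φ p = (ε (proj₁ p) , proj₂ p) ∷ []
        supported : ∀ G → SupportedOn In•⊗ (selected [] X φ G)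
        supported G (P , Q) with P ≟F unitF
        ... | yes P≡unit = inj₁ P≡unit
        ... | no  P≢unit = inj₂ (if-then-0 (selects [] X (P , Q)) (coeff-ε-nonunit _≟F_ Q G P≢unit))
        at-unit : ∀ F G → labelsF F ↭ X → selected [] X φ G (unitF , F) ≈ Coefficients.kronecker _≟F_ F G
        at-unit F G F↭X rewrite sameLabels-↭ F↭X = +-identityʳ _

lemma3p8 : ∀ {c ℓ} (K : Field c ℓ) → CharZero K → (w : Field.Carrier K) →
    let open ADF K w in
    (δ : Forest → Lin (Forest × Forest)) → IsΔ δ →
    (X : List ℕ) → Unique X →
    (v : Lin Forest) → All (λ e → labelsF (proj₂ e) ↭ X) v →
    (id⊗ε (proj X [] (Δ̂ δ v)) ≈F v) × (ε⊗id (proj [] X (Δ̂ δ v)) ≈F v)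
lemma3p8 K _ w δ isΔ X UX v v⊆X = counit-⊗• X UX v v⊆X , counit-•⊗ X UX v v⊆X
  where open CounitLaws K w δ isΔ
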